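{- Let $r \geq 0$ be an integer, $\Sigma$ a finite signature of relation symbols and constants, and $S = (U,\sigma)$ a structure over $\Sigma$ whose universe $U$ is infinite and whose relations $\sigma(\mathsf{R})$ are all finite. Let $\mathrm{Dom}(\sigma)$ be the (finite) set of elements of $U$ that occur in some tuple of some $\sigma(\mathsf{R})$, $\mathsf{R}\in\Sigma$, or equal $\sigma(\mathsf{c})$ for some constant $\mathsf{c}\in\Sigma$. For $n\ge 0$ let $S^n$ be the finite structure over $\Sigma$ with universe $\mathrm{Dom}(\sigma)\cup\{v_1,\ldots,v_n\}$, where $v_1,\ldots,v_n\in U\setminus \mathrm{Dom}(\sigma)$ are pairwise distinct, and with the same interpretation $\sigma$ of all symbols. Then $\mathrm{type}_r(S) = \mathrm{type}_r(S^{2^r})$.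
   Context: For a structure $S$ over a signature $\Sigma$ and an integer $r\ge 0$, the $r$-type $\mathrm{type}_r(S)$ is the set of monadic second-order (MSO) sentences over $\Sigma$ of quantifier rank at most $r$ (taken up to logical equivalence) that hold in $S$. The quantifier rank is the maximal nesting depth of first-order and second-order (set) quantifiers. -}

module Defs where

open import Level using (0ℓ)
open import Data.Nat using (ℕ; suc; _⊔_)
open import Data.Fin using (Fin)
open import Data.Bool using (Bool; true)
open import Data.Vec using (Vec; toList)
import Data.Vec as Vec
open import Data.List using (List; tabulate; concat; map; _++_)
open import Data.List.Membership.Propositional using (_∈_)
open import Data.List.Membership.Propositional.Properties using (∈-tabulate⁺; ∈-++⁺ˡ)
open import Data.Product using (Σ; _×_)
open import Data.Unit using (⊤)
open import Data.Sum using (_⊎_)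
open import Relation.Nullary using (¬_)
open import Relation.Binary.PropositionalEquality using (_≡_)

record Sig : Set where
  field
    nRel  : ℕ
    arity : Fin nRel → ℕ
    nCon  : ℕ
open Sig public

-- MSO syntax (de Bruijn): m first-order variables, k set variables.

data Term (Γ : Sig) (m : ℕ) : Set where
  var : Fin m → Term Γ m
  con : Fin (nCon Γ) → Term Γ m

data Formula (Γ : Sig) : ℕ → ℕ → Set where
  rel  : ∀ {m k} (R : Fin (nRel Γ)) → Vec (Term Γ m) (arity Γ R) → Formula Γ m k
  eq   : ∀ {m k} → Term Γ m → Term Γ m → Formula Γ m k
  mem  : ∀ {m k} → Term Γ m → Fin k → Formula Γ m k
  neg  : ∀ {m k} → Formula Γ m k → Formula Γ m k
  conj : ∀ {m k} → Formula Γ m k → Formula Γ m k → Formula Γ m k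
  disj : ∀ {m k} → Formula Γ m k → Formula Γ m k → Formula Γ m k
  ex₁  : ∀ {m k} → Formula Γ (suc m) k → Formula Γ m k
  all₁ : ∀ {m k} → Formula Γ (suc m) k → Formula Γ m k
  ex₂  : ∀ {m k} → Formula Γ m (suc k) → Formula Γ m k
  all₂ : ∀ {m k} → Formula Γ m (suc k) → Formula Γ m k

Sentence : Sig → Set
Sentence Γ = Formula Γ 0 0

qr : ∀ {Γ m k} → Formula Γ m k → ℕ
qr (rel R ts) = 0
qr (eq s t)   = 0
qr (mem t X)  = 0
qr (neg φ)    = qr φ
qr (conj φ ψ) = qr φ ⊔ qr ψ
qr (disj φ ψ) = qr φ ⊔ qr ψ
qr (ex₁ φ)    = suc (qr φ)
qr (all₁ φ)   = suc (qr φ)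
qr (ex₂ φ)    = suc (qr φ)
qr (all₂ φ)   = suc (qr φ)

-- Structures and (Tarskian) satisfaction.  Sets of elements are
-- represented by characteristic functions A → Bool (all subsets, under
-- the classical reading).

record Structure (Γ : Sig) : Set₁ where
  field
    Carrier : Set
    relI    : (R : Fin (nRel Γ)) → Vec Carrier (arity Γ R) → Set
    conI    : Fin (nCon Γ) → Carrier
open Structure public

module _ {Γ : Sig} (M : Structure Γ) where
  evalT : ∀ {m} → (Fin m → Carrier M) → Term Γ m → Carrier M
  evalT ρ (var i) = ρ i
  evalT ρ (con c) = conI M c

  extend : ∀ {n} {A : Set} → A → (Fin n → A) → Fin (suc n) → A
  extend a ρ Fin.zero    = a
  extend a ρ (Fin.suc i) = ρ i

  Sat : ∀ {m k} → Formula Γ m k → (Fin m → Carrier M) → (Fin k → Carrier M → Bool) → Set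
  Sat (rel R ts) ρ η = relI M R (Vec.map (evalT ρ) ts)
  Sat (eq s t)   ρ η = evalT ρ s ≡ evalT ρ t
  Sat (mem t X)  ρ η = η X (evalT ρ t) ≡ true
  Sat (neg φ)    ρ η = ¬ Sat φ ρ η
  Sat (conj φ ψ) ρ η = Sat φ ρ η × Sat ψ ρ η
  Sat (disj φ ψ) ρ η = Sat φ ρ η ⊎ Sat ψ ρ η
  Sat (ex₁ φ)    ρ η = Σ (Carrier M) λ a → Sat φ (extend a ρ) η
  Sat (all₁ φ)   ρ η = (a : Carrier M) → Sat φ (extend a ρ) η
  Sat (ex₂ φ)    ρ η = Σ (Carrier M → Bool) λ X → Sat φ ρ (extend X η)
  Sat (all₂ φ)   ρ η = (X : Carrier M → Bool) → Sat φ ρ (extend X η)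

  noVars : ∀ {A : Set} → Fin 0 → A
  noVars ()

  _⊨_ : Sentence Γ → Set
  _⊨_ φ = Sat φ noVars noVars

record Interp (Γ : Sig) (U : Set) : Set where
  field
    relσ : (R : Fin (nRel Γ)) → List (Vec U (arity Γ R))
    conσ : Fin (nCon Γ) → U
open Interp public

full : ∀ {Γ U} → Interp Γ U → Structure Γ
full {U = U} σ = record
  { Carrier = U
  ; relI    = λ R t → t ∈ relσ σ R
  ; conI    = conσ σ }

Dom : ∀ {Γ U} → Interp Γ U → List U
Dom {Γ} σ = tabulate (conσ σ)
         ++ concat (tabulate (λ R → concat (map toList (relσ σ R))))

Infinite : Set → Set
Infinite U = ¬ (Σ (List U) λ xs → (u : U) → u ∈ xs)

-- elements of a sub-universe given by a list D (membership proof irrelevant,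
-- so the carrier is exactly the set of elements of D)
record Elem {U : Set} (D : List U) : Set where
  constructor elem
  field
    val   : U
    .inD  : val ∈ D
open Elem public

con∈Dom : ∀ {Γ U} (σ : Interp Γ U) (vs : List U) c → conσ σ c ∈ (Dom σ ++ vs)
con∈Dom σ vs c = ∈-++⁺ˡ (∈-++⁺ˡ (∈-tabulate⁺ c))

sub : ∀ {Γ U} → Interp Γ U → List U → Structure Γ
sub σ vs = record
  { Carrier = Elem (Dom σ ++ vs)
  ; relI    = λ R t → Vec.map val t ∈ relσ σ R
  ; conI    = λ c → elem (conσ σ c) (con∈Dom σ vs c) }

SameType : ∀ {Γ} → ℕ → Structure Γ → Structure Γ → Set
SameType {Γ} r M N = (φ : Sentence Γ) → qr φ Data.Nat.≤ r → (M ⊨ φ → N ⊨ φ) × (N ⊨ φ → M ⊨ φ)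

-- An Ehrenfeucht–Fraïssé argument.  Only the elements of Dom σ occur in relations or as
-- constants, so in a position of the game every other element is described by whether it
-- has been chosen and by its colour, i.e. its membership pattern in the chosen sets.
-- Duplicator keeps the chosen elements in correspondence, maps Dom σ identically, and keeps,
-- for every colour, the numbers of unchosen elements outside Dom σ equal up to the threshold
-- 2ⁿ when n rounds remain.  A point move uses up one such element, and 2ⁿ⁺¹ ≥ 2ⁿ + 1.  A set
-- move splits every colour class in two, and a class known up to 2ⁿ⁺¹ = 2ⁿ + 2ⁿ can be split
-- so that both halves match the opponent's halves up to 2ⁿ.  At the start there is a single
-- colour: S has infinitely many elements outside Dom σ and S^(2^r) has exactly 2^r.
module Submission where

open import Defs
open import Level using (0ℓ)
open import Axiom.ExcludedMiddle using (ExcludedMiddle)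
open import Data.Nat using (ℕ; zero; suc; _+_; _*_; _^_; _≤_; _<_; z≤n; s≤s)
open import Data.Nat.Properties
  using (≤-refl; ≤-trans; ≤-reflexive; <-irrefl; ≤∧≢⇒<; ≤-<-connex; n≤1+n; m≤m+n; m≤n⇒m<n∨m≡n;
         +-suc; +-identityʳ; +-mono-≤; +-monoˡ-≤; +-cancelˡ-≤; m≤n⇒m⊓n≡m; m⊔n≤o⇒m≤o; m⊔n≤o⇒n≤o;
         m^n>0; module ≤-Reasoning)
open import Data.Fin using (Fin; zero; suc)
open import Data.Vec as Vec using (Vec; []; _∷_; lookup; tabulate; toList)
open import Data.Vec.Properties using (map-id; lookup∘tabulate; tabulate∘lookup; tabulate-cong)
open import Data.Bool using (Bool; true; false; not)
open import Data.Bool.Properties using (not-¬; ¬-not)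
open import Data.List as List using (List; []; _∷_; length; _++_; take; filter)
open import Data.List.Properties using (length-++; length-take)
open import Data.List.Membership.Propositional using (_∈_; _∉_)
open import Data.List.Membership.Propositional.Properties
  using (∈-++⁺ˡ; ∈-++⁺ʳ; ∈-tabulate⁺; ∈-concat⁺′; ∈-map⁺)
open import Data.List.Relation.Unary.Any using (here; there)
open import Data.List.Relation.Unary.All as All using (All; []; _∷_)
import Data.List.Relation.Unary.All.Properties as All
open import Data.List.Relation.Unary.AllPairs using ([]; _∷_)
open import Data.List.Relation.Unary.Unique.Propositional using (Unique)
import Data.List.Relation.Unary.Unique.Propositional.Properties as Unique
open import Data.Product as Product using (Σ; Σ-syntax; _×_; _,_; proj₁; proj₂)
open import Data.Sum as Sum using (_⊎_; inj₁; inj₂; [_,_])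
open import Data.Empty using (⊥; ⊥-elim)
open import Function using (_∘_; id)
open import Relation.Nullary using (¬_; Dec; yes; no)
open import Relation.Nullary.Decidable using (decidable-stable)
open import Relation.Unary using (Decidable; _≐_)
open import Relation.Unary.Properties using (∁?; ≐-sym; ≐-trans)
open import Relation.Binary.PropositionalEquality
  using (_≡_; _≢_; refl; sym; trans; cong; cong₂; subst)

private
  variable
    C D : Set
    P Q : C → Set
    i j p q K : ℕ

+-≤-double : i ≤ K → j ≤ K → i + j ≤ 2 * K
+-≤-double {K = K} i≤K j≤K =
  ≤-trans (+-mono-≤ i≤K j≤K) (≤-reflexive (cong (K +_) (sym (+-identityʳ K))))

length-filter+length-filter-∁ : (P? : Decidable P) (xs : List C) →
  length (filter P? xs) + length (filter (∁? P?) xs) ≡ length xs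
length-filter+length-filter-∁ P? [] = refl
length-filter+length-filter-∁ P? (x ∷ xs) with P? x
... | yes _ = cong suc (length-filter+length-filter-∁ P? xs)
... | no _  = trans (+-suc _ _) (cong suc (length-filter+length-filter-∁ P? xs))

AtLeast : ℕ → (C → Set) → Set
AtLeast {C} j P = Σ[ xs ∈ List C ] length xs ≡ j × Unique xs × All P xs

AtLeast-map : (∀ {x} → P x → Q x) → AtLeast j P → AtLeast j Q
AtLeast-map f (xs , len , uniq , all) = xs , len , uniq , All.map f all

AtLeast-zero : AtLeast 0 P
AtLeast-zero = [] , refl , [] , []

AtLeast-∷ : ∀ {a} → P a → AtLeast j (λ x → P x × x ≢ a) → AtLeast (suc j) P
AtLeast-∷ Pa (xs , len , uniq , all) =
  _ ∷ xs , cong suc len , All.map (λ (_ , x≢a) → x≢a ∘ sym) all ∷ uniq , Pa ∷ All.map proj₁ all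

AtLeast-witness : AtLeast 1 P → Σ C P
AtLeast-witness (_ ∷ _ , _ , _ , Px ∷ _) = _ , Px

AtLeast-fromList : (xs : List C) → Unique xs → All P xs → i ≤ length xs → AtLeast i P
AtLeast-fromList {i = i} xs uniq all i≤len =
  take i xs , trans (length-take i xs) (m≤n⇒m⊓n≡m i≤len) , Unique.take⁺ i uniq , All.take⁺ i all

AtLeast-≤ : i ≤ j → AtLeast j P → AtLeast i P
AtLeast-≤ i≤j (xs , refl , uniq , all) = AtLeast-fromList xs uniq all i≤j

AtLeast-+ : {R S : C → Set} → AtLeast p (λ x → P x × R x) → AtLeast q (λ x → P x × S x) →
  (∀ {x} → R x → S x → ⊥) → AtLeast (p + q) P
AtLeast-+ (xs , refl , uxs , rxs) (ys , refl , uys , sys) disjoint =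
  xs ++ ys , length-++ xs ,
  Unique.++⁺ uxs uys
    (λ (x∈xs , x∈ys) → disjoint (proj₂ (All.lookup rxs x∈xs)) (proj₂ (All.lookup sys x∈ys))) ,
  All.++⁺ (All.map proj₁ rxs) (All.map proj₁ sys)

AtLeast-Elem : {L : List C} (ws : List C) → All (_∈ L) ws → Unique ws → All P ws →
  AtLeast (length ws) (λ (y : Elem L) → P (val y))
AtLeast-Elem [] [] [] [] = AtLeast-zero
AtLeast-Elem (w ∷ ws) (w∈L ∷ ws∈L) (w∉ws ∷ uniq) (Pw ∷ Pws) = AtLeast-∷ {a = elem w w∈L} Pw
  (AtLeast-map (λ (Py , y≢w) → Py , λ { refl → y≢w refl })
    (AtLeast-Elem ws ws∈L uniq (All.zip (Pws , All.map (λ w≢y → w≢y ∘ sym) w∉ws))))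

record CappedCount {C : Set} (K : ℕ) (P : C → Set) : Set where
  field
    count         : ℕ
    count≤K       : count ≤ K
    atLeastCount  : AtLeast count P
    count-maximal : j ≤ K → AtLeast j P → j ≤ count

infix 4 _≈[_]_

_≈[_]_ : (C → Set) → ℕ → (D → Set) → Set
P ≈[ K ] Q = ∀ {j} → j ≤ K → (AtLeast j P → AtLeast j Q) × (AtLeast j Q → AtLeast j P)

≈-sym : P ≈[ K ] Q → Q ≈[ K ] P
≈-sym P≈Q j≤K = proj₂ (P≈Q j≤K) , proj₁ (P≈Q j≤K)

≈-weaken : i ≤ K → P ≈[ K ] Q → P ≈[ i ] Q
≈-weaken i≤K P≈Q j≤i = P≈Q (≤-trans j≤i i≤K)

≈-cong : {P′ : C → Set} {Q′ : D → Set} → P ≐ P′ → Q ≐ Q′ → P ≈[ K ] Q → P′ ≈[ K ] Q′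
≈-cong (P⊆P′ , P′⊆P) (Q⊆Q′ , Q′⊆Q) P≈Q j≤K =
  AtLeast-map Q⊆Q′ ∘ proj₁ (P≈Q j≤K) ∘ AtLeast-map P′⊆P ,
  AtLeast-map P⊆P′ ∘ proj₂ (P≈Q j≤K) ∘ AtLeast-map Q′⊆Q

≈-unbounded : (∀ {j} → j ≤ K → AtLeast j P) → (∀ {j} → j ≤ K → AtLeast j Q) → P ≈[ K ] Q
≈-unbounded manyP manyQ j≤K = (λ _ → manyQ j≤K) , (λ _ → manyP j≤K)

Painted : (C → Set) → (C → Bool) → Bool → C → Set
Painted P X b x = P x × X x ≡ b

Painted-cong : {X Y : C → Bool} → (∀ {x} → P x → X x ≡ Y x) → ∀ {b} → Painted P X b ≐ Painted P Y b
Painted-cong X≡Y = (λ (Px , Xx≡b) → Px , trans (sym (X≡Y Px)) Xx≡b)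
                 , (λ (Px , Yx≡b) → Px , trans (X≡Y Px) Yx≡b)

module Counting (em : ExcludedMiddle 0ℓ) where

  AtLeast-partition : (R : C → Set) → AtLeast (p + q) P →
    AtLeast (suc p) (λ x → P x × R x) ⊎ AtLeast q (λ x → P x × ¬ R x)
  AtLeast-partition {C = C} {p = p} {q = q} {P = P} R (xs , len , uniq , all) =
    [ (λ ys≤p → inj₂ (AtLeast-fromList zs (Unique.filter⁺ (∁? R?) uniq) (filtered (∁? R?)) (q≤zs ys≤p)))
    , (λ p<ys → inj₁ (AtLeast-fromList ys (Unique.filter⁺ R? uniq) (filtered R?) p<ys))
    ] (≤-<-connex (length ys) p)
    where
    R? : Decidable R
    R? _ = em

    ys zs : List C
    ys = filter R? xs
    zs = filter (∁? R?) xs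

    filtered : {S : C → Set} (S? : Decidable S) → All (λ x → P x × S x) (filter S? xs)
    filtered S? = All.zip (All.filter⁺ S? all , All.all-filter S? xs)

    q≤zs : length ys ≤ p → q ≤ length zs
    q≤zs ys≤p = +-cancelˡ-≤ p _ _ (begin
      p + q                 ≡⟨ sym len ⟩
      length xs             ≡⟨ sym (length-filter+length-filter-∁ R? xs) ⟩
      length ys + length zs ≤⟨ +-monoˡ-≤ (length zs) ys≤p ⟩
      p + length zs         ∎)
      where open ≤-Reasoning

  AtLeast-remove : (b : C) → AtLeast (suc j) P → AtLeast j (λ x → P x × x ≢ b)
  AtLeast-remove {P = P} b at = [ ⊥-elim ∘ noTwoEqual , id ] (AtLeast-partition {p = 1} (_≡ b) at)
    where
    noTwoEqual : ¬ AtLeast 2 (λ x → P x × x ≡ b)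
    noTwoEqual (_ ∷ _ ∷ [] , _ , (x≢y ∷ []) ∷ _ , (_ , refl) ∷ (_ , refl) ∷ []) = x≢y refl

  AtLeast-removeAll : (L : List C) → AtLeast (length L + j) P → AtLeast j (λ x → P x × x ∉ L)
  AtLeast-removeAll []      at = AtLeast-map (λ Px → Px , λ ()) at
  AtLeast-removeAll (b ∷ L) at = AtLeast-map
    (λ ((Px , x≢b) , x∉L) → Px , λ { (here x≡b) → x≢b x≡b ; (there x∈L) → x∉L x∈L })
    (AtLeast-removeAll L (AtLeast-remove b at))

  AtLeast-∈-length : (L : List C) → AtLeast j (_∈ L) → j ≤ length L
  AtLeast-∈-length {j = zero}  L       _  = z≤n
  AtLeast-∈-length {j = suc j} []      (_ ∷ _ , _ , _ , () ∷ _)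
  AtLeast-∈-length {j = suc j} (b ∷ L) at = s≤s (AtLeast-∈-length L (AtLeast-map
    (λ { (here x≡b , x≢b) → ⊥-elim (x≢b x≡b) ; (there x∈L , _) → x∈L })
    (AtLeast-remove b at)))

  cappedCount : (K : ℕ) (P : C → Set) → CappedCount K P
  cappedCount zero P = record
    { count = 0 ; count≤K = z≤n ; atLeastCount = AtLeast-zero ; count-maximal = λ j≤0 _ → j≤0 }
  cappedCount (suc K) P with em {AtLeast (suc K) P}
  ... | yes many = record
    { count = suc K ; count≤K = ≤-refl ; atLeastCount = many ; count-maximal = λ j≤1+K _ → j≤1+K }
  ... | no ¬many = record
    { count = count ; count≤K = ≤-trans count≤K (n≤1+n K) ; atLeastCount = atLeastCount
    ; count-maximal = maximal }
    where
    open CappedCount (cappedCount K P)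
    maximal : j ≤ suc K → AtLeast j P → j ≤ count
    maximal j≤1+K at with m≤n⇒m<n∨m≡n j≤1+K
    ... | inj₁ (s≤s j≤K) = count-maximal j≤K at
    ... | inj₂ refl      = ⊥-elim (¬many at)

  ≈-delete : ∀ {a b} → (P a → Q b) → (Q b → P a) → P ≈[ suc K ] Q →
    (λ x → P x × x ≢ a) ≈[ K ] (λ y → Q y × y ≢ b)
  ≈-delete {P = P} {K = K} {a = a} Pa⇒Qb Qb⇒Pa P≈Q with em {P a}
  ... | yes Pa = λ j≤K → shift P≈Q Pa (Pa⇒Qb Pa) j≤K , shift (≈-sym P≈Q) (Pa⇒Qb Pa) Pa j≤K
    where
    shift : ∀ {C D} {P : C → Set} {Q : D → Set} {a b} → P ≈[ suc K ] Q → P a → Q b →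
      j ≤ K → AtLeast j (λ x → P x × x ≢ a) → AtLeast j (λ y → Q y × y ≢ b)
    shift P≈Q Pa Qb j≤K = AtLeast-remove _ ∘ proj₁ (P≈Q (s≤s j≤K)) ∘ AtLeast-∷ Pa
  ... | no ¬Pa = ≈-cong (drop ¬Pa) (drop (¬Pa ∘ Qb⇒Pa)) (≈-weaken (n≤1+n K) P≈Q)
    where
    drop : ∀ {C} {P : C → Set} {a} → ¬ P a → P ≐ (λ x → P x × x ≢ a)
    drop ¬Pa = (λ Px → Px , λ { refl → ¬Pa Px }) , proj₁

  module _ {P : C → Set} {Q : D → Set} {K : ℕ} (P≈Q : P ≈[ 2 * K ] Q) (X : C → Bool) where

    Splits : (D → Bool) → Bool → Set
    Splits T b = Painted P X b ≈[ K ] Painted Q T b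

    private
      paint : Bool → {A : Set} → Dec A → Bool
      paint b (yes _) = b
      paint b (no _)  = not b

      paint-yes : ∀ b {A} (d : Dec A) → A → paint b d ≡ b
      paint-yes b (yes _) _ = refl
      paint-yes b (no ¬a) a = ⊥-elim (¬a a)

      paint-no : ∀ b {A} (d : Dec A) → ¬ A → paint b d ≡ not b
      paint-no b (yes a) ¬a = ⊥-elim (¬a a)
      paint-no b (no _)  _  = refl

      paint-≡ : ∀ b {A} (d : Dec A) → paint b d ≡ b → A
      paint-≡ b (yes a) _ = a
      paint-≡ b (no _)  e = ⊥-elim (not-¬ refl (sym e))

      paint-≡not : ∀ b {A} (d : Dec A) → paint b d ≡ not b → ¬ A
      paint-≡not b (yes _) e = ⊥-elim (not-¬ refl e)
      paint-≡not b (no ¬a) _ = ¬a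

    -- T paints b on a list L of exactly `count` elements of Q and ¬ b elsewhere.  This copies the
    -- b-class, and also the (¬ b)-class, provided that the b-class of X is not capped at K or the
    -- (¬ b)-class already reaches K.
    splitWith : (b : Bool) (c : CappedCount K (Painted P X b)) →
      CappedCount.count c < K ⊎ AtLeast K (Painted P X (not b)) →
      Σ[ T ∈ (D → Bool) ] Splits T b × Splits T (not b)
    splitWith b c fewOrManyOther = paintList (proj₁ (P≈Q count≤2K) (AtLeast-map proj₁ atLeastCount))
      where
      open CappedCount c

      count≤2K : count ≤ 2 * K
      count≤2K = ≤-trans count≤K (m≤m+n K _)

      paintList : AtLeast count Q → Σ[ T ∈ (D → Bool) ] Splits T b × Splits T (not b)
      paintList (L , refl , uniqueL , allQ) = T , same , other
        where
        T : D → Bool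
        T y = paint b (em {y ∈ L})

        inL : AtLeast count (λ y → Q y × y ∈ L)
        inL = L , refl , uniqueL , All.zip (allQ , All.tabulate id)

        same : Splits T b
        same j≤K = (λ at → AtLeast-map (λ (Qy , y∈L) → Qy , paint-yes b em y∈L)
                                        (AtLeast-≤ (count-maximal j≤K at) inL))
                 , (λ at → AtLeast-≤ (AtLeast-∈-length L (AtLeast-map (paint-≡ b em ∘ proj₂) at))
                                     atLeastCount)

        other : Splits T (not b)
        other {j} j≤K = forth , back
          where
          forth : AtLeast j (Painted P X (not b)) → AtLeast j (Painted Q T (not b))
          forth at = AtLeast-map (λ (Qy , y∉L) → Qy , paint-no b em y∉L) (AtLeast-removeAll L
            (proj₁ (P≈Q (+-≤-double count≤K j≤K)) (AtLeast-+ atLeastCount at not-¬)))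

          tooMany : AtLeast (suc count) (Painted P X b) → AtLeast j (Painted P X (not b))
          tooMany at = [ (λ count<K → ⊥-elim (<-irrefl refl (count-maximal count<K at)))
                       , AtLeast-≤ j≤K
                       ] fewOrManyOther

          back : AtLeast j (Painted Q T (not b)) → AtLeast j (Painted P X (not b))
          back at = [ tooMany , AtLeast-map (λ (Px , Xx≢b) → Px , ¬-not Xx≢b) ]
            (AtLeast-partition (λ x → X x ≡ b) (proj₂ (P≈Q (+-≤-double count≤K j≤K))
              (AtLeast-+ inL (AtLeast-map (λ (Qy , Ty≡¬b) → Qy , paint-≡not b em Ty≡¬b) at)
                         (λ y∈L y∉L → y∉L y∈L))))

    split : Σ[ T ∈ (D → Bool) ] ∀ b → Splits T b
    split = byMajority em
      where
      bothBits : ∀ b → Σ[ T ∈ (D → Bool) ] Splits T b × Splits T (not b) →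
        Σ[ T ∈ (D → Bool) ] ∀ b → Splits T b
      bothBits true  (T , t , f) = T , λ { true → t ; false → f }
      bothBits false (T , f , t) = T , λ { true → t ; false → f }

      byMajority : Dec (AtLeast K (Painted P X false)) → Σ[ T ∈ (D → Bool) ] ∀ b → Splits T b
      byMajority (yes manyFalse) = bothBits true (splitWith true (cappedCount K _) (inj₂ manyFalse))
      byMajority (no ¬manyFalse) = bothBits false (splitWith false c (inj₁ (≤∧≢⇒< count≤K count≢K)))
        where
        c : CappedCount K (Painted P X false)
        c = cappedCount K (Painted P X false)
        open CappedCount c
        count≢K : count ≢ K
        count≢K count≡K = ¬manyFalse (subst (λ n → AtLeast n _) count≡K atLeastCount)

  Infinite⇒outside : {U : Set} → Infinite U → (L : List U) → Σ[ u ∈ U ] u ∉ L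
  Infinite⇒outside {U} inf L with em {Σ[ u ∈ U ] u ∉ L}
  ... | yes found = found
  ... | no none   = ⊥-elim (inf (L , λ u → decidable-stable em (λ u∉L → none (u , u∉L))))

  Infinite⇒AtLeast∉ : {U : Set} → Infinite U → (L : List U) → ∀ j → AtLeast j (_∉ L)
  Infinite⇒AtLeast∉ inf L zero = AtLeast-zero
  Infinite⇒AtLeast∉ inf L (suc j) with Infinite⇒AtLeast∉ inf L j
  ... | xs , len , uniq , xs∉L with Infinite⇒outside inf (L ++ xs)
  ...   | u , u∉L++xs = AtLeast-∷ (u∉L++xs ∘ ∈-++⁺ˡ) (xs , len , uniq , All.zip (xs∉L , All.tabulate
          (λ x∈xs x≡u → u∉L++xs (∈-++⁺ʳ L (subst (_∈ xs) x≡u x∈xs)))))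

val-injective : {L : List C} {a b : Elem L} → val a ≡ val b → a ≡ b
val-injective {a = elem _ _} {elem _ _} refl = refl

module BackAndForth (em : ExcludedMiddle 0ℓ) {Γ : Sig} {U : Set} (σ : Interp Γ U) where
  open Counting em

  -- Both S and Sⁿ are presented this way, with emb the inclusion into U.
  record EmbeddedStructure : Set₁ where
    field
      structure     : Structure Γ
      emb           : Carrier structure → U
      emb-injective : ∀ {a b} → emb a ≡ emb b → a ≡ b
      emb-onto-Dom  : ∀ {d} → d ∈ Dom σ → Σ[ a ∈ Carrier structure ] emb a ≡ d
      rel⇒          : ∀ R t → relI structure R t → Vec.map emb t ∈ relσ σ R
      rel⇐          : ∀ R t → Vec.map emb t ∈ relσ σ R → relI structure R t
      emb-con       : ∀ c → emb (conI structure c) ≡ conσ σ c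
  open EmbeddedStructure

  El : EmbeddedStructure → Set
  El A = Carrier (structure A)

  Env : EmbeddedStructure → ℕ → Set
  Env A m = Fin m → El A

  Colouring : EmbeddedStructure → ℕ → Set
  Colouring A k = Fin k → El A → Bool

  private
    variable
      n m k : ℕ

  emb-con∈Dom : ∀ A c → emb A (conI (structure A) c) ∈ Dom σ
  emb-con∈Dom A c = subst (_∈ Dom σ) (sym (emb-con A c)) (∈-++⁺ˡ (∈-tabulate⁺ c))

  tuple⊆Dom : ∀ {R} {t : Vec U (arity Γ R)} → t ∈ relσ σ R → ∀ {x} → x ∈ toList t → x ∈ Dom σ
  tuple⊆Dom {R} t∈R x∈t = ∈-++⁺ʳ (List.tabulate (conσ σ))
    (∈-concat⁺′ (∈-concat⁺′ x∈t (∈-map⁺ toList t∈R)) (∈-tabulate⁺ R))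

  record Matched {k} (A B : EmbeddedStructure) (η : Colouring A k) (η′ : Colouring B k)
                 (a : El A) (b : El B) : Set where
    field
      dom⇒       : emb A a ∈ Dom σ → emb A a ≡ emb B b
      dom⇐       : emb B b ∈ Dom σ → emb A a ≡ emb B b
      sameColour : ∀ Z → η Z a ≡ η′ Z b
  open Matched

  module _ {A B : EmbeddedStructure} {k} {η : Colouring A k} {η′ : Colouring B k} where

    Matched-sym : ∀ {a b} → Matched A B η η′ a b → Matched B A η′ η b a
    Matched-sym m = record { dom⇒ = sym ∘ dom⇐ m ; dom⇐ = sym ∘ dom⇒ m ; sameColour = sym ∘ sameColour m }

    matched-≡ : ∀ {a a′ b b′} → Matched A B η η′ a b → Matched A B η η′ a′ b′ →
      emb A a ≡ emb A a′ → emb A a ∈ Dom σ → b ≡ b′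
    matched-≡ m m′ a↦a′ a∈Dom = emb-injective B
      (trans (sym (dom⇒ m a∈Dom)) (trans a↦a′ (dom⇒ m′ (subst (_∈ Dom σ) a↦a′ a∈Dom))))

  record Fresh (A : EmbeddedStructure) {m k} (ρ : Env A m) (η : Colouring A k)
               (c : Vec Bool k) (x : El A) : Set where
    field
      ∉Dom     : emb A x ∉ Dom σ
      unchosen : ∀ i → ρ i ≢ x
      coloured : ∀ Z → η Z x ≡ lookup c Z
  open Fresh

  record Position (n : ℕ) (A B : EmbeddedStructure) {m k} (ρ : Env A m) (η : Colouring A k)
                  (ρ′ : Env B m) (η′ : Colouring B k) : Set where
    field
      matched     : ∀ i → Matched A B η η′ (ρ i) (ρ′ i)
      ≡⇒          : ∀ i j → ρ i ≡ ρ j → ρ′ i ≡ ρ′ j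
      ≡⇐          : ∀ i j → ρ′ i ≡ ρ′ j → ρ i ≡ ρ j
      domColour   : ∀ a b → emb A a ≡ emb B b → emb A a ∈ Dom σ → ∀ Z → η Z a ≡ η′ Z b
      freshCounts : ∀ c → Fresh A ρ η c ≈[ 2 ^ n ] Fresh B ρ′ η′ c
  open Position

  record Response (A B : EmbeddedStructure) {m k} (ρ : Env A m) (η : Colouring A k)
                  (ρ′ : Env B m) (η′ : Colouring B k) (a : El A) (b : El B) : Set where
    field
      matches : Matched A B η η′ a b
      chosen⇒ : ∀ i → ρ i ≡ a → ρ′ i ≡ b
      chosen⇐ : ∀ i → ρ′ i ≡ b → ρ i ≡ a
  open Response

  module _ {A : EmbeddedStructure} {m k} {ρ : Env A m} {η : Colouring A k} where

    Fresh-extend₁ : ∀ {a c} → Fresh A (extend (structure A) a ρ) η c ≐ (λ x → Fresh A ρ η c x × x ≢ a)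
    Fresh-extend₁ =
        (λ f → record { ∉Dom = ∉Dom f ; unchosen = unchosen f ∘ suc ; coloured = coloured f }
             , unchosen f zero ∘ sym)
      , (λ (f , x≢a) → record
          { ∉Dom     = ∉Dom f
          ; unchosen = λ { zero → x≢a ∘ sym ; (suc i) → unchosen f i }
          ; coloured = coloured f })

    Fresh-extend₂ : ∀ {X b c} → Fresh A ρ (extend (structure A) X η) (b ∷ c) ≐ Painted (Fresh A ρ η c) X b
    Fresh-extend₂ =
        (λ f → record { ∉Dom = ∉Dom f ; unchosen = unchosen f ; coloured = coloured f ∘ suc }
             , coloured f zero)
      , (λ (f , Xx≡b) → record
          { ∉Dom = ∉Dom f ; unchosen = unchosen f ; coloured = λ { zero → Xx≡b ; (suc Z) → coloured f Z } })

  module _ {A B : EmbeddedStructure} {m k} {ρ : Env A m} {η : Colouring A k}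
           {ρ′ : Env B m} {η′ : Colouring B k} where

    Position-sym : Position n A B ρ η ρ′ η′ → Position n B A ρ′ η′ ρ η
    Position-sym pos = record
      { matched     = Matched-sym ∘ matched pos
      ; ≡⇒          = ≡⇐ pos
      ; ≡⇐          = ≡⇒ pos
      ; domColour   = λ b a b↦a b∈Dom Z → sym (domColour pos a b (sym b↦a) (subst (_∈ Dom σ) b↦a b∈Dom) Z)
      ; freshCounts = ≈-sym ∘ freshCounts pos }

    Response-sym : ∀ {a b} → Response A B ρ η ρ′ η′ a b → Response B A ρ′ η′ ρ η b a
    Response-sym r = record
      { matches = Matched-sym (matches r) ; chosen⇒ = chosen⇐ r ; chosen⇐ = chosen⇒ r }

    Fresh-respond : ∀ {a b c} → Response A B ρ η ρ′ η′ a b → Fresh A ρ η c a → Fresh B ρ′ η′ c b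
    Fresh-respond r fa = record
      { ∉Dom     = λ b∈Dom → ∉Dom fa (subst (_∈ Dom σ) (sym (dom⇐ (matches r) b∈Dom)) b∈Dom)
      ; unchosen = λ i ρ′i≡b → unchosen fa i (chosen⇐ r i ρ′i≡b)
      ; coloured = λ Z → trans (sym (sameColour (matches r) Z)) (coloured fa Z) }

  module _ {A B : EmbeddedStructure} {m k} {ρ : Env A m} {η : Colouring A k}
           {ρ′ : Env B m} {η′ : Colouring B k} where

    Position-extend₁ : ∀ {a b} → Position (suc n) A B ρ η ρ′ η′ → Response A B ρ η ρ′ η′ a b →
      Position n A B (extend (structure A) a ρ) η (extend (structure B) b ρ′) η′
    Position-extend₁ {n = n} pos r = record
      { matched     = λ { zero → matches r ; (suc i) → matched pos i }
      ; ≡⇒          = λ { zero zero _ → refl ; zero (suc j) e → sym (chosen⇒ r j (sym e))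
                        ; (suc i) zero e → chosen⇒ r i e ; (suc i) (suc j) e → ≡⇒ pos i j e }
      ; ≡⇐          = λ { zero zero _ → refl ; zero (suc j) e → sym (chosen⇐ r j (sym e))
                        ; (suc i) zero e → chosen⇐ r i e ; (suc i) (suc j) e → ≡⇐ pos i j e }
      ; domColour   = domColour pos
      ; freshCounts = λ c → ≈-cong (≐-sym Fresh-extend₁) (≐-sym Fresh-extend₁)
          (≈-delete (Fresh-respond r) (Fresh-respond (Response-sym r))
            (≈-weaken (+-≤-double (m^n>0 2 n) ≤-refl) (freshCounts pos c))) }

    respond-chosen : Position n A B ρ η ρ′ η′ → ∀ i → Response A B ρ η ρ′ η′ (ρ i) (ρ′ i)
    respond-chosen pos i = record
      { matches = matched pos i ; chosen⇒ = λ j → ≡⇒ pos j i ; chosen⇐ = λ j → ≡⇐ pos j i }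

    respond-Dom : Position n A B ρ η ρ′ η′ → ∀ {a} → emb A a ∈ Dom σ →
      Σ[ b ∈ El B ] Response A B ρ η ρ′ η′ a b
    respond-Dom pos {a} a∈Dom = b , record
      { matches = ab
      ; chosen⇒ = λ j ρj≡a → matched-≡ (matched pos j) ab (cong (emb A) ρj≡a)
                               (subst (_∈ Dom σ) (sym (cong (emb A) ρj≡a)) a∈Dom)
      ; chosen⇐ = λ j ρ′j≡b → matched-≡ (Matched-sym (matched pos j)) (Matched-sym ab) (cong (emb B) ρ′j≡b)
                                (subst (_∈ Dom σ) (sym (trans (cong (emb B) ρ′j≡b) b↦a)) a∈Dom) }
      where
      b : El B
      b = proj₁ (emb-onto-Dom B a∈Dom)
      b↦a : emb B b ≡ emb A a
      b↦a = proj₂ (emb-onto-Dom B a∈Dom)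
      ab : Matched A B η η′ a b
      ab = record
        { dom⇒ = λ _ → sym b↦a ; dom⇐ = λ _ → sym b↦a ; sameColour = domColour pos a b (sym b↦a) a∈Dom }

    respond-fresh : Position n A B ρ η ρ′ η′ → ∀ {a} → (∀ i → ρ i ≢ a) → emb A a ∉ Dom σ →
      Σ[ b ∈ El B ] Response A B ρ η ρ′ η′ a b
    respond-fresh {n = n} pos {a} a-unchosen a∉Dom = b , record
      { matches = record
          { dom⇒       = ⊥-elim ∘ a∉Dom
          ; dom⇐       = ⊥-elim ∘ ∉Dom fb
          ; sameColour = λ Z → trans (coloured fa Z) (sym (coloured fb Z)) }
      ; chosen⇒ = λ j ρj≡a → ⊥-elim (a-unchosen j ρj≡a)
      ; chosen⇐ = λ j ρ′j≡b → ⊥-elim (unchosen fb j ρ′j≡b) }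
      where
      c : Vec Bool k
      c = tabulate (λ Z → η Z a)
      fa : Fresh A ρ η c a
      fa = record { ∉Dom = a∉Dom ; unchosen = a-unchosen ; coloured = λ Z → sym (lookup∘tabulate _ Z) }
      witness : Σ (El B) (Fresh B ρ′ η′ c)
      witness = AtLeast-witness (proj₁ (freshCounts pos c (m^n>0 2 n)) (AtLeast-∷ fa AtLeast-zero))
      b : El B
      b = proj₁ witness
      fb : Fresh B ρ′ η′ c b
      fb = proj₂ witness

    respond₁ : Position n A B ρ η ρ′ η′ → (a : El A) → Σ[ b ∈ El B ] Response A B ρ η ρ′ η′ a b
    respond₁ pos a with em {Σ[ i ∈ Fin m ] ρ i ≡ a} | em {emb A a ∈ Dom σ}
    ... | yes (i , refl) | _         = ρ′ i , respond-chosen pos i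
    ... | no _           | yes a∈Dom = respond-Dom pos a∈Dom
    ... | no unchosen′   | no a∉Dom  = respond-fresh pos (λ i ρi≡a → unchosen′ (i , ρi≡a)) a∉Dom

    module SetCopy {n} (pos : Position (suc n) A B ρ η ρ′ η′) (X : El A → Bool) where

      splitting : ∀ c → Σ[ T ∈ (El B → Bool) ] ∀ b →
        Painted (Fresh A ρ η c) X b ≈[ 2 ^ n ] Painted (Fresh B ρ′ η′ c) T b
      splitting c = split (freshCounts pos c) X

      T : Vec Bool k → El B → Bool
      T c = proj₁ (splitting c)

      copy : (y : El B) → Dec (Σ[ i ∈ Fin m ] ρ′ i ≡ y) → Dec (emb B y ∈ Dom σ) → Bool
      copy y (yes (i , _)) _           = X (ρ i)
      copy y (no _)        (yes y∈Dom) = X (proj₁ (emb-onto-Dom A y∈Dom))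
      copy y (no _)        (no _)      = T (tabulate (λ Z → η′ Z y)) y

      X′ : El B → Bool
      X′ y = copy y em em

      copy-chosen : ∀ i d d′ → X (ρ i) ≡ copy (ρ′ i) d d′
      copy-chosen i (yes (j , ρ′j≡ρ′i)) _ = cong X (≡⇐ pos i j (sym ρ′j≡ρ′i))
      copy-chosen i (no unchosen′)      _ = ⊥-elim (unchosen′ (i , refl))

      copy-Dom : ∀ a b → emb A a ≡ emb B b → emb A a ∈ Dom σ → ∀ d d′ → X a ≡ copy b d d′
      copy-Dom a b a↦b a∈Dom (yes (j , ρ′j≡b)) _ = cong X (sym (emb-injective A
        (trans (dom⇐ (matched pos j) (subst (_∈ Dom σ) (trans a↦b (sym ρ′j↦b)) a∈Dom))
               (trans ρ′j↦b (sym a↦b)))))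
        where
        ρ′j↦b : emb B (ρ′ j) ≡ emb B b
        ρ′j↦b = cong (emb B) ρ′j≡b
      copy-Dom a b a↦b a∈Dom (no _) (yes b∈Dom) =
        cong X (emb-injective A (trans a↦b (sym (proj₂ (emb-onto-Dom A b∈Dom)))))
      copy-Dom a b a↦b a∈Dom (no _) (no b∉Dom) = ⊥-elim (b∉Dom (subst (_∈ Dom σ) a↦b a∈Dom))

      copy-fresh : ∀ {c y} d d′ → Fresh B ρ′ η′ c y → copy y d d′ ≡ T c y
      copy-fresh (yes (i , ρ′i≡y)) _           fy = ⊥-elim (unchosen fy i ρ′i≡y)
      copy-fresh (no _)            (yes y∈Dom) fy = ⊥-elim (∉Dom fy y∈Dom)
      copy-fresh {c} {y} (no _)    (no _)      fy =
        cong (λ c′ → T c′ y) (trans (tabulate-cong (coloured fy)) (tabulate∘lookup c))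

    respond₂ : Position (suc n) A B ρ η ρ′ η′ → (X : El A → Bool) →
      Σ[ X′ ∈ (El B → Bool) ] Position n A B ρ (extend (structure A) X η) ρ′ (extend (structure B) X′ η′)
    respond₂ pos X = X′ , record
      { matched     = λ i → record
          { dom⇒       = dom⇒ (matched pos i)
          ; dom⇐       = dom⇐ (matched pos i)
          ; sameColour = λ { zero → copy-chosen i em em ; (suc Z) → sameColour (matched pos i) Z } }
      ; ≡⇒          = ≡⇒ pos
      ; ≡⇐          = ≡⇐ pos
      ; domColour   = λ a b a↦b a∈Dom →
          λ { zero → copy-Dom a b a↦b a∈Dom em em ; (suc Z) → domColour pos a b a↦b a∈Dom Z }
      ; freshCounts = λ { (b ∷ c) → ≈-cong (≐-sym Fresh-extend₂)
          (≐-sym (≐-trans Fresh-extend₂ (Painted-cong (copy-fresh em em))))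
          (proj₂ (splitting c) b) } }
      where open SetCopy pos X

  module _ {A B : EmbeddedStructure} {m k} {ρ : Env A m} {η : Colouring A k}
           {ρ′ : Env B m} {η′ : Colouring B k} (pos : Position n A B ρ η ρ′ η′) where

    private
      ⟦_⟧ : Term Γ m → El A
      ⟦_⟧ = evalT (structure A) ρ
      ⟦_⟧′ : Term Γ m → El B
      ⟦_⟧′ = evalT (structure B) ρ′

    term-matched : ∀ t → Matched A B η η′ ⟦ t ⟧ ⟦ t ⟧′
    term-matched (var i) = matched pos i
    term-matched (con c) = record
      { dom⇒ = λ _ → con↦ ; dom⇐ = λ _ → con↦ ; sameColour = domColour pos _ _ con↦ (emb-con∈Dom A c) }
      where
      con↦ : emb A (conI (structure A) c) ≡ emb B (conI (structure B) c)
      con↦ = trans (emb-con A c) (sym (emb-con B c))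

    term-≡ : ∀ s t → ⟦ s ⟧ ≡ ⟦ t ⟧ → ⟦ s ⟧′ ≡ ⟦ t ⟧′
    term-≡ (var i) (var j) e = ≡⇒ pos i j e
    term-≡ (con c) t       e =
      matched-≡ (term-matched (con c)) (term-matched t) (cong (emb A) e) (emb-con∈Dom A c)
    term-≡ (var i) (con c) e = sym (term-≡ (con c) (var i) (sym e))

    terms-emb : ∀ {l} (ts : Vec (Term Γ m) l) →
      (∀ {x} → x ∈ toList (Vec.map (emb A) (Vec.map ⟦_⟧ ts)) → x ∈ Dom σ) →
      Vec.map (emb B) (Vec.map ⟦_⟧′ ts) ≡ Vec.map (emb A) (Vec.map ⟦_⟧ ts)
    terms-emb []       _      = refl
    terms-emb (t ∷ ts) ts⊆Dom =
      cong₂ _∷_ (sym (dom⇒ (term-matched t) (ts⊆Dom (here refl)))) (terms-emb ts (ts⊆Dom ∘ there))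

    rel-transfer : ∀ R ts → relI (structure A) R (Vec.map ⟦_⟧ ts) → relI (structure B) R (Vec.map ⟦_⟧′ ts)
    rel-transfer R ts holdsA = rel⇐ B R _ (subst (_∈ relσ σ R) (sym (terms-emb ts (tuple⊆Dom inR))) inR)
      where
      inR : Vec.map (emb A) (Vec.map ⟦_⟧ ts) ∈ relσ σ R
      inR = rel⇒ A R _ holdsA

  transfer : ∀ {A B m k} {ρ : Env A m} {η : Colouring A k} {ρ′ : Env B m} {η′ : Colouring B k}
    (φ : Formula Γ m k) → qr φ ≤ n →
    Position n A B ρ η ρ′ η′ → Sat (structure A) φ ρ η → Sat (structure B) φ ρ′ η′
  transfer (rel R ts) _ pos = rel-transfer pos R ts
  transfer (eq s t)   _ pos = term-≡ pos s t
  transfer (mem t Z)  _ pos = trans (sym (sameColour (term-matched pos t) Z))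
  transfer (neg φ) φ≤n pos ¬Aφ Bφ = ¬Aφ (transfer φ φ≤n (Position-sym pos) Bφ)
  transfer (conj φ ψ) φψ≤n pos =
    Product.map (transfer φ (m⊔n≤o⇒m≤o _ _ φψ≤n) pos) (transfer ψ (m⊔n≤o⇒n≤o _ _ φψ≤n) pos)
  transfer (disj φ ψ) φψ≤n pos =
    Sum.map (transfer φ (m⊔n≤o⇒m≤o _ _ φψ≤n) pos) (transfer ψ (m⊔n≤o⇒n≤o _ _ φψ≤n) pos)
  transfer (ex₁ φ) (s≤s φ≤n) pos (a , Aφ) =
    let b , r = respond₁ pos a in b , transfer φ φ≤n (Position-extend₁ pos r) Aφ
  transfer (all₁ φ) (s≤s φ≤n) pos Aφ b =
    let a , r = respond₁ (Position-sym pos) b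
    in transfer φ φ≤n (Position-sym (Position-extend₁ (Position-sym pos) r)) (Aφ a)
  transfer (ex₂ φ) (s≤s φ≤n) pos (X , Aφ) =
    let X′ , pos′ = respond₂ pos X in X′ , transfer φ φ≤n pos′ Aφ
  transfer (all₂ φ) (s≤s φ≤n) pos Aφ Y =
    let Y′ , pos′ = respond₂ (Position-sym pos) Y in transfer φ φ≤n (Position-sym pos′) (Aφ Y′)

  fullStructure : EmbeddedStructure
  fullStructure = record
    { structure     = full σ
    ; emb           = id
    ; emb-injective = id
    ; emb-onto-Dom  = λ {d} _ → d , refl
    ; rel⇒          = λ R t → subst (_∈ relσ σ R) (sym (map-id t))
    ; rel⇐          = λ R t → subst (_∈ relσ σ R) (map-id t)
    ; emb-con       = λ _ → refl }

  subStructure : List U → EmbeddedStructure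
  subStructure vs = record
    { structure     = sub σ vs
    ; emb           = val
    ; emb-injective = val-injective
    ; emb-onto-Dom  = λ {d} d∈Dom → elem d (∈-++⁺ˡ d∈Dom) , refl
    ; rel⇒          = λ _ _ → id
    ; rel⇐          = λ _ _ → id
    ; emb-con       = λ _ → refl }

  initialPosition : ∀ {r vs} → Infinite U → length vs ≡ 2 ^ r → Unique vs → All (_∉ Dom σ) vs →
    Position r fullStructure (subStructure vs)
      (noVars (full σ)) (noVars (full σ)) (noVars (sub σ vs)) (noVars (sub σ vs))
  initialPosition {vs = vs} inf len uniq vs∉Dom = record
    { matched     = λ ()
    ; ≡⇒          = λ ()
    ; ≡⇐          = λ ()
    ; domColour   = λ _ _ _ _ ()
    ; freshCounts = λ { [] → ≈-unbounded
        (λ {j} _ → AtLeast-map outsideDom (Infinite⇒AtLeast∉ inf (Dom σ) j))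
        (λ j≤2^r → AtLeast-map outsideDom (AtLeast-≤ (≤-trans j≤2^r (≤-reflexive (sym len)))
                     (AtLeast-Elem vs (All.tabulate (∈-++⁺ʳ (Dom σ))) uniq vs∉Dom))) } }
    where
    outsideDom : ∀ {A} {ρ : Env A 0} {η : Colouring A 0} {x} → emb A x ∉ Dom σ → Fresh A ρ η [] x
    outsideDom x∉Dom = record { ∉Dom = x∉Dom ; unchosen = λ () ; coloured = λ () }

mainTheorem1 : ExcludedMiddle 0ℓ →
    (r : ℕ) (Γ : Sig) (U : Set) (σ : Interp Γ U) → Infinite U →
    (vs : List U) → length vs ≡ 2 ^ r → Unique vs → All (_∉ Dom σ) vs →
    SameType r (full σ) (sub σ vs)
mainTheorem1 em r Γ U σ inf vs len uniq vs∉Dom φ φ≤r =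
  transfer φ φ≤r start , transfer φ φ≤r (Position-sym start)
  where
  open BackAndForth em σ
  start : Position r fullStructure (subStructure vs)
            (noVars (full σ)) (noVars (full σ)) (noVars (sub σ vs)) (noVars (sub σ vs))
  start = initialPosition inf len uniq vs∉Dom
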